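{- Let $G=(V,E)$ be a control-flow graph with entry $s$ and terminal $t$ as in the context, let $H$ be its edge subdivision, and let $C$ be a strongly connected component, with $|C|\ge 2$, of the union of the forward and backward inference graphs of $H$. Then the vertices of $C$ form a directed path in $H$ whose vertices alternate between $V$ and $V_E$.
   Context: $G=(V,E)$ is a finite directed graph (possibly with parallel edges) with distinct nodes $s,t$ such that $s$ has in-degree $0$, $t$ has out-degree $0$, every node is reachable from $s$ and every node can reach $t$ by directed paths. Its edge subdivision is the directed graph $H$ with vertex set $V\cup V_E$, $V_E=\{v_e:e\in E\}$ new vertices, and edge set $\bigcup_{e=(u,v)\in E}\{(u,v_e),(v_e,v)\}$, with entry $s$ and terminal $t$. For a vertex $u$ of $H$: $N^{in}(u),N^{out}(u)$ are its in- and out-neighbour sets in $H$; $A(u)$ is the set of vertices reachable from $s$ by a directed path in $H$ avoiding $u$; $B(u)$ is the set of vertices that can reach $t$ by a directed path in $H$ avoiding $u$. A vertex $u$ is forward inferable if $N^{out}(u)\setminus A(u)\neq\emptyset$ and $N^{out}(u)\cap A(u)\cap B(u)=\emptyset$; the forward inference graph has an edge $(u,v)$ iff $u$ is forward inferable and $v\in N^{out}(u)\setminus A(u)$. A vertex $u$ is backward inferable if $N^{in}(u)\setminus B(u)\neq\emptyset$ and $N^{in}(u)\cap A(u)\cap B(u)=\emptyset$; the backward inference graph has an edge $(u,v)$ iff $u$ is backward inferable and $v\in N^{in}(u)\setminus B(u)$. -}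

module Defs where

open import Data.Nat using (ℕ)
open import Data.Fin using (Fin)
open import Data.Sum using (_⊎_; inj₁; inj₂)
open import Data.Product using (Σ; ∃; _×_; _,_)
open import Data.Bool using (Bool; true; false)
open import Data.Empty using (⊥)
open import Data.List using (List)
open import Data.List.Membership.Propositional using (_∈_)
open import Data.List.Relation.Unary.Unique.Propositional using (Unique)
open import Data.List.Relation.Unary.Linked using (Linked)
open import Relation.Nullary using (¬_)
open import Relation.Binary.PropositionalEquality using (_≡_; _≢_)
open import Relation.Binary.Construct.Closure.ReflexiveTransitive using (Star)

GEdge : {n m : ℕ} → (Fin m → Fin n) → (Fin m → Fin n) → Fin n → Fin n → Set
GEdge {m = m} src tgt u v = Σ (Fin m) λ e → (src e ≡ u) × (tgt e ≡ v)

record CFG : Set where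
  field
    n m   : ℕ
    src   : Fin m → Fin n
    tgt   : Fin m → Fin n
    s t   : Fin n
    s≢t   : s ≢ t
    s-in0  : ∀ e → tgt e ≢ s
    t-out0 : ∀ e → src e ≢ t
    reach-s : ∀ v → Star (GEdge src tgt) s v
    reach-t : ∀ v → Star (GEdge src tgt) v t

module _ (G : CFG) where
  open CFG G

  -- Vertices of the edge subdivision H: V ⊎ V_E  (inj₂ e is v_e).
  HV : Set
  HV = Fin n ⊎ Fin m

  data HEdge : HV → HV → Set where
    out-e : (e : Fin m) → HEdge (inj₁ (src e)) (inj₂ e)
    e-in  : (e : Fin m) → HEdge (inj₂ e) (inj₁ (tgt e))

  hs ht : HV
  hs = inj₁ s
  ht = inj₁ t

  data ReachAvoid (u : HV) : HV → HV → Set where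
    here : ∀ {x} → x ≢ u → ReachAvoid u x x
    step : ∀ {x z y} → x ≢ u → HEdge x z → ReachAvoid u z y → ReachAvoid u x y

  A : HV → HV → Set
  A u x = ReachAvoid u hs x

  B : HV → HV → Set
  B u x = ReachAvoid u x ht

  ForwardInferable : HV → Set
  ForwardInferable u =
    (∃ λ v → HEdge u v × ¬ A u v) ×
    (∀ v → HEdge u v → A u v → B u v → ⊥)

  BackwardInferable : HV → Set
  BackwardInferable u =
    (∃ λ v → HEdge v u × ¬ B u v) ×
    (∀ v → HEdge v u → A u v → B u v → ⊥)

  FEdge : HV → HV → Set
  FEdge u v = ForwardInferable u × HEdge u v × ¬ A u v

  BEdge : HV → HV → Set
  BEdge u v = BackwardInferable u × HEdge v u × ¬ B u v

  IEdge : HV → HV → Set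
  IEdge u v = FEdge u v ⊎ BEdge u v

  IReach : HV → HV → Set
  IReach = Star IEdge

  record IsSCC (C : HV → Set) : Set where
    field
      nonempty  : ∃ C
      connected : ∀ x y → C x → C y → IReach x y
      maximal   : ∀ x y → C x → IReach x y → IReach y x → C y

  AtLeastTwo : (HV → Set) → Set
  AtLeastTwo C = ∃ λ x → ∃ λ y → C x × C y × x ≢ y

  inV : HV → Bool
  inV (inj₁ _) = true
  inV (inj₂ _) = false

  IsAlternatingPathOn : (HV → Set) → List HV → Set
  IsAlternatingPathOn C ps =
    Unique ps ×
    (∀ x → (x ∈ ps → C x) × (C x → x ∈ ps)) ×
    Linked HEdge ps ×
    Linked (λ x y → inV x ≢ inV y) ps

{-# OPTIONS --safe #-}
-- Every inference edge runs along an edge of H, in one direction or the other.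
-- Along a cycle of the inference graph each edge also occurs reversed: otherwise
-- A(v_e) or B(v_e) would be closed along the cycle and contain v_e itself.  So
-- adjacent vertices of a component are joined by an H-edge p → q that is
-- forward-inferred from p and backward-inferred from q.  This relation is
-- deterministic in both directions (v_e has one successor, and if a → v_f is
-- such an edge then every path from a to t leaves a through v_f) and acyclic
-- (p strictly dominates q), so the component is the trace of one maximal walk.
module Submission where

open import Defs
open import Data.Nat using (ℕ)
open import Data.Fin using (Fin; zero; suc)
import Data.Fin.Properties as Fin
open import Data.Fin.Subset using (Subset; ⊤; _-_; _⊂_) renaming (_∈_ to _∈ₛ_; _∉_ to _∉ₛ_)
open import Data.Fin.Subset.Properties using (_∈?_; ∈⊤; p─q⊆p; x∈p∧x≢y⇒x∈p-y; x∈p⇒p-x⊂p)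
open import Data.Fin.Subset.Induction using (Acc; acc; ⊂-wellFounded)
open import Data.Vec using (_∷_; here; there)
open import Data.List using (List; []; _∷_)
open import Data.List.Membership.Propositional using (_∈_)
open import Data.List.Relation.Unary.Any using (here; there)
open import Data.List.Relation.Unary.All as All using ([])
open import Data.List.Relation.Unary.AllPairs using ([]; _∷_)
open import Data.List.Relation.Unary.Unique.Propositional using (Unique)
open import Data.List.Relation.Unary.Linked as Linked using (Linked; [-]; _∷_)
open import Data.Product using (∃; _×_; _,_; proj₁; map₂)
open import Data.Sum using (_⊎_; inj₁; inj₂)
import Data.Sum as Sum
open import Data.Sum.Properties using (inj₁-injective)
open import Data.Empty using (⊥; ⊥-elim)
open import Function using (_∘_; id; flip; _↔_; Inverse)
open import Relation.Nullary using (¬_; Dec; yes; no)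
open import Relation.Nullary.Decidable using (map′; ¬?; _×-dec_)
open import Relation.Binary.Definitions using (Decidable; DecidableEquality; Transitive)
open import Relation.Binary.Rewriting using (Deterministic)
open import Relation.Binary.PropositionalEquality using (_≡_; _≢_; refl; sym; trans; cong; subst; module ≡-Reasoning)
open import Relation.Binary.Construct.Closure.ReflexiveTransitive as Star using (Star; ε; _◅_; _◅◅_; reverse)

Acyclic : {V : Set} → (V → V → Set) → Set
Acyclic R = ∀ {x y} → R x y → Star R y x → ⊥

Star-pull : {V : Set} {R : V → V → Set} {P : V → Set} →
            (∀ {x y} → R x y → P y → P x) → ∀ {x y} → Star R x y → P y → P x
Star-pull pull ε       = id
Star-pull pull (r ◅ w) = pull r ∘ Star-pull pull w

x∉p-x : ∀ {n} (p : Subset n) (x : Fin n) → x ∉ₛ p - x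
x∉p-x (_ ∷ p) zero    ()
x∉p-x (_ ∷ p) (suc x) (there x∈p-x) = x∉p-x p x x∈p-x

module Walk {V : Set} {R : V → V → Set} where

  private variable x y z z′ : V

  trace : Star R x y → List V
  trace {x} ε       = x ∷ []
  trace {x} (_ ◅ w) = x ∷ trace w

  start∈trace : (w : Star R x y) → x ∈ trace w
  start∈trace ε       = here refl
  start∈trace (_ ◅ _) = here refl

  trace-linked : (w : Star R x y) → Linked R (trace w)
  trace-linked ε            = [-]
  trace-linked (r ◅ ε)      = r ∷ [-]
  trace-linked (r ◅ r′ ◅ w) = r ∷ trace-linked (r′ ◅ w)

  trace-reachable : (w : Star R x y) → z ∈ trace w → Star R x z
  trace-reachable ε       (here refl) = ε
  trace-reachable (_ ◅ _) (here refl) = ε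
  trace-reachable (r ◅ w) (there z∈w) = r ◅ trace-reachable w z∈w

  trace-unique : Acyclic R → (w : Star R x y) → Unique (trace w)
  trace-unique acyclic ε       = [] ∷ []
  trace-unique acyclic (r ◅ w) =
    All.tabulate (λ z∈w x≡z → acyclic r (subst (Star R _) (sym x≡z) (trace-reachable w z∈w)))
    ∷ trace-unique acyclic w

  trace-closedᶠ : Deterministic _≡_ R → (∀ z → ¬ R y z) →
                  (w : Star R x y) → z ∈ trace w → R z z′ → z′ ∈ trace w
  trace-closedᶠ _   sink ε       (here refl) r  = ⊥-elim (sink _ r)
  trace-closedᶠ det sink (r ◅ w) (here refl) r′ = there (subst (_∈ trace w) (det r r′) (start∈trace w))
  trace-closedᶠ det sink (r ◅ w) (there z∈w) r′ = there (trace-closedᶠ det sink w z∈w r′)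

  trace-closedᵇ : Deterministic _≡_ (flip R) →
                  (w : Star R x y) → z ∈ trace w → R z′ z → z′ ∈ trace w ⊎ z ≡ x
  trace-closedᵇ _     ε       (here refl) _  = inj₂ refl
  trace-closedᵇ _     (_ ◅ _) (here refl) _  = inj₂ refl
  trace-closedᵇ codet (r ◅ w) (there z∈w) r′ with trace-closedᵇ codet w z∈w r′
  ... | inj₁ z′∈w = inj₁ (there z′∈w)
  ... | inj₂ refl = inj₁ (here (codet r′ r))

  trace-closed : Deterministic _≡_ R → Deterministic _≡_ (flip R) →
                 (∀ z → ¬ R z x) → (∀ z → ¬ R y z) →
                 (w : Star R x y) → z ∈ trace w → R z z′ ⊎ R z′ z → z′ ∈ trace w
  trace-closed det _     _      sink w z∈w (inj₁ r) = trace-closedᶠ det sink w z∈w r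
  trace-closed _   codet source _    w z∈w (inj₂ r) with trace-closedᵇ codet w z∈w r
  ... | inj₁ z′∈w = z′∈w
  ... | inj₂ refl = ⊥-elim (source _ r)

module Finite {V : Set} {N : ℕ} (enum : Fin N ↔ V) where

  open Inverse enum using (to; strictlyInverseˡ)
  open Inverse enum public using (from)

  private variable u w x y z : V

  from-injective : from x ≡ from y → x ≡ y
  from-injective {x} {y} eq = begin
    x              ≡⟨ strictlyInverseˡ x ⟨
    to (from x)    ≡⟨ cong to eq ⟩
    to (from y)    ≡⟨ strictlyInverseˡ y ⟩
    y              ∎
    where open ≡-Reasoning

  _≟_ : DecidableEquality V
  x ≟ y = map′ from-injective (cong from) (from x Fin.≟ from y)

  ∃? : {P : V → Set} → (∀ x → Dec (P x)) → Dec (∃ P)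
  ∃? {P} P? = map′ (λ (i , p) → to i , p)
                   (λ (x , p) → from x , subst P (sym (strictlyInverseˡ x)) p)
                   (Fin.any? (P? ∘ to))

  ≢⇒∈⊤- : x ≢ u → from x ∈ₛ ⊤ - from u
  ≢⇒∈⊤- x≢u = x∈p∧x≢y⇒x∈p-y ∈⊤ (x≢u ∘ from-injective)

  ∈⊤-⇒≢ : from x ∈ₛ ⊤ - from u → x ≢ u
  ∈⊤-⇒≢ {u = u} x∈ refl = x∉p-x ⊤ (from u) x∈

  sink-reachable : {R : V → V → Set} → Decidable R → Acyclic R →
                   ∀ x → ∃ λ y → Star R x y × (∀ z → ¬ R y z)
  sink-reachable {R} R? acyclic x = go (⊂-wellFounded ⊤) x (λ _ _ → ∈⊤)
    where
    -- p contains every vertex strictly after x, so it shrinks along the walk.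
    go : ∀ {p} → Acc _⊂_ p → ∀ x → (∀ {y z} → R x y → Star R y z → from z ∈ₛ p) →
         ∃ λ y → Star R x y × (∀ z → ¬ R y z)
    go (acc smaller) x after with ∃? (R? x)
    ... | no no-succ = x , ε , λ z r → no-succ (z , r)
    ... | yes (y , r) with go (smaller (x∈p⇒p-x⊂p (after r ε))) y
                              (λ r′ w → x∈p∧x≢y⇒x∈p-y (after r (r′ ◅ w))
                                          (λ eq → acyclic r′ (subst (Star R _) (from-injective eq) w)))
    ...   | z , w , sink = z , r ◅ w , sink

  source-reaching : {R : V → V → Set} → Decidable R → Acyclic R →
                    ∀ x → ∃ λ y → Star R y x × (∀ z → ¬ R z y)
  source-reaching R? acyclic x with sink-reachable (flip R?) (λ r w → acyclic r (reverse id w)) x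
  ... | y , w , source = y , reverse id w , source

  module Paths (R : V → V → Set) (R? : Decidable R) where

    data PathIn (p : Subset N) : V → V → Set where
      here : from x ∈ₛ p → PathIn p x x
      step : from x ∈ₛ p → R x z → PathIn p z y → PathIn p x y

    PathIn-start : ∀ {p} → PathIn p x y → from x ∈ₛ p
    PathIn-start (here x∈p)     = x∈p
    PathIn-start (step x∈p _ _) = x∈p

    PathIn-weaken : ∀ {p} q → PathIn (p - q) x y → PathIn p x y
    PathIn-weaken {p = p} q (here x∈)     = here (p─q⊆p p _ x∈)
    PathIn-weaken {p = p} q (step x∈ r π) = step (p─q⊆p p _ x∈) r (PathIn-weaken q π)

    avoid-or-last-exit : ∀ {p} → x ≢ y → PathIn p w y →
                         PathIn (p - from x) w y ⊎ ∃ λ z → R x z × PathIn (p - from x) z y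
    avoid-or-last-exit x≢y (here y∈p) =
      inj₁ (here (x∈p∧x≢y⇒x∈p-y y∈p (x≢y ∘ sym ∘ from-injective)))
    avoid-or-last-exit {x = x} x≢y (step {x = w} w∈p r π) with avoid-or-last-exit x≢y π
    ... | inj₂ exit = inj₂ exit
    ... | inj₁ π′ with w ≟ x
    ...   | yes refl = inj₂ (_ , r , π′)
    ...   | no w≢x   = inj₁ (step (x∈p∧x≢y⇒x∈p-y w∈p (w≢x ∘ from-injective)) r π′)

    last-exit : ∀ {p} → x ≢ y → PathIn p x y → ∃ λ z → R x z × PathIn (p - from x) z y
    last-exit {x = x} x≢y π with avoid-or-last-exit x≢y π
    ... | inj₁ π′   = ⊥-elim (x∉p-x _ (from x) (PathIn-start π′))
    ... | inj₂ exit = exit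

    PathIn-acc? : ∀ {p} → Acc _⊂_ p → ∀ x y → Dec (PathIn p x y)
    PathIn-acc? {p} (acc smaller) x y with from x ∈? p | x ≟ y
    ... | no x∉p  | _        = no (x∉p ∘ PathIn-start)
    ... | yes x∈p | yes refl = yes (here x∈p)
    ... | yes x∈p | no x≢y   =
      map′ (λ (z , r , π) → step x∈p r (PathIn-weaken (from x) π)) (last-exit x≢y)
           (∃? λ z → R? x z ×-dec PathIn-acc? (smaller (x∈p⇒p-x⊂p x∈p)) z y)

    PathIn? : ∀ p → Decidable (PathIn p)
    PathIn? p = PathIn-acc? (⊂-wellFounded p)

module Subdivision (G : CFG) where

  open CFG G
  open Walk
  open Finite (Fin.+↔⊎ {n} {m})

  private variable
    a b : Fin n
    e : Fin m
    p q u w x y z : HV G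

  HEdge? : Decidable (HEdge G)
  HEdge? (inj₁ a) (inj₂ e) with src e Fin.≟ a
  ... | yes refl = yes (out-e e)
  ... | no src≢a = no λ { (out-e _) → src≢a refl }
  HEdge? (inj₂ e) (inj₁ b) with tgt e Fin.≟ b
  ... | yes refl = yes (e-in e)
  ... | no tgt≢b = no λ { (e-in _) → tgt≢b refl }
  HEdge? (inj₁ _) (inj₁ _) = no λ ()
  HEdge? (inj₂ _) (inj₂ _) = no λ ()

  HEdge-alternates : HEdge G x y → inV G x ≢ inV G y
  HEdge-alternates (out-e _) ()
  HEdge-alternates (e-in _)  ()

  pred-of-edge : HEdge G x (inj₂ e) → x ≡ inj₁ (src e)
  pred-of-edge (out-e _) = refl

  succ-of-edge : HEdge G (inj₂ e) y → y ≡ inj₁ (tgt e)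
  succ-of-edge (e-in _) = refl

  subdivide : Star (GEdge src tgt) a b → Star (HEdge G) (inj₁ a) (inj₁ b)
  subdivide ε                       = ε
  subdivide ((e , refl , refl) ◅ w) = out-e e ◅ e-in e ◅ subdivide w

  ReachAvoid-start : ReachAvoid G u x y → x ≢ u
  ReachAvoid-start (here x≢u)     = x≢u
  ReachAvoid-start (step x≢u _ _) = x≢u

  ReachAvoid-end : ReachAvoid G u x y → y ≢ u
  ReachAvoid-end (here y≢u)   = y≢u
  ReachAvoid-end (step _ _ π) = ReachAvoid-end π

  ReachAvoid-snoc : ReachAvoid G u x y → HEdge G y z → z ≢ u → ReachAvoid G u x z
  ReachAvoid-snoc (here y≢u)      e z≢u = step y≢u e (here z≢u)
  ReachAvoid-snoc (step x≢u e′ π) e z≢u = step x≢u e′ (ReachAvoid-snoc π e z≢u)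

  open Paths (HEdge G) HEdge?

  ReachAvoid⇒PathIn : ReachAvoid G u x y → PathIn (⊤ - from u) x y
  ReachAvoid⇒PathIn (here x≢u)     = here (≢⇒∈⊤- x≢u)
  ReachAvoid⇒PathIn (step x≢u e π) = step (≢⇒∈⊤- x≢u) e (ReachAvoid⇒PathIn π)

  PathIn⇒ReachAvoid : PathIn (⊤ - from u) x y → ReachAvoid G u x y
  PathIn⇒ReachAvoid (here x∈)     = here (∈⊤-⇒≢ x∈)
  PathIn⇒ReachAvoid (step x∈ e π) = step (∈⊤-⇒≢ x∈) e (PathIn⇒ReachAvoid π)

  ReachAvoid? : ∀ u x y → Dec (ReachAvoid G u x y)
  ReachAvoid? u x y = map′ PathIn⇒ReachAvoid ReachAvoid⇒PathIn (PathIn? (⊤ - from u) x y)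

  avoid-or-reach : ∀ q → ReachAvoid G u x y → ReachAvoid G q x y ⊎ ReachAvoid G u x q
  avoid-or-reach q (here {x} x≢u) with x ≟ q
  ... | yes refl = inj₂ (here x≢u)
  ... | no x≢q   = inj₁ (here x≢q)
  avoid-or-reach q (step {x} x≢u e π) with x ≟ q
  ... | yes refl = inj₂ (here x≢u)
  ... | no x≢q   = Sum.map (step x≢q e) (step x≢u e) (avoid-or-reach q π)

  avoid-or-from : ∀ q → ReachAvoid G u x y → ReachAvoid G q x y ⊎ ReachAvoid G u q y
  avoid-or-from q (here {x} x≢u) with x ≟ q
  ... | yes refl = inj₂ (here x≢u)
  ... | no x≢q   = inj₁ (here x≢q)
  avoid-or-from q π@(step {x} x≢u e π′) with avoid-or-from q π′ | x ≟ q
  ... | inj₂ π″ | _        = inj₂ π″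
  ... | inj₁ _  | yes refl = inj₂ π
  ... | inj₁ π″ | no x≢q   = inj₁ (step x≢q e π″)

  first-visit : Star (HEdge G) x y → x ≢ u →
                ReachAvoid G u x y ⊎ ∃ λ z → HEdge G z u × ReachAvoid G u x z
  first-visit ε x≢u = inj₁ (here x≢u)
  first-visit {x} {u = u} (_◅_ {j = z} e w) x≢u with z ≟ u
  ... | yes refl = inj₂ (x , e , here x≢u)
  ... | no z≢u   = Sum.map (step x≢u e) (map₂ (map₂ (step x≢u e))) (first-visit w z≢u)

  last-visit : Star (HEdge G) x y → y ≢ u →
               ReachAvoid G u x y ⊎ ∃ λ z → HEdge G u z × ReachAvoid G u z y
  last-visit ε y≢u = inj₁ (here y≢u)
  last-visit {x} {u = u} (_◅_ {j = z} e w) y≢u with last-visit w y≢u | x ≟ u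
  ... | inj₂ exit | _        = inj₂ exit
  ... | inj₁ π    | yes refl = inj₂ (z , e , π)
  ... | inj₁ π    | no x≢u   = inj₁ (step x≢u e π)

  avoid-sole-pred : (∀ {x} → HEdge G x w → x ≡ u) → x ≢ w → ReachAvoid G u x y → ReachAvoid G w x y
  avoid-sole-pred sole x≢w (here _) = here x≢w
  avoid-sole-pred {w = w} sole x≢w (step {z = z} x≢u e π) with z ≟ w
  ... | yes refl = ⊥-elim (x≢u (sole e))
  ... | no z≢w   = step x≢w e (avoid-sole-pred sole z≢w π)

  avoid-sole-succ : (∀ {y} → HEdge G w y → y ≡ u) → y ≢ w → ReachAvoid G u x y → ReachAvoid G w x y
  avoid-sole-succ sole y≢w (here _) = here y≢w
  avoid-sole-succ {w = w} sole y≢w (step {x = x} x≢u e π) with x ≟ w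
  ... | yes refl = ⊥-elim (ReachAvoid-start π (sole e))
  ... | no x≢w   = step x≢w e (avoid-sole-succ sole y≢w π)

  pred∈A : HEdge G x (inj₂ e) → A G (inj₂ e) x
  pred∈A (out-e e) with first-visit (subdivide (reach-s (src e))) (λ ())
  ... | inj₁ α                 = α
  ... | inj₂ (_ , out-e _ , α) = α

  succ∈B : HEdge G (inj₂ e) y → B G (inj₂ e) y
  succ∈B (e-in e) with last-visit (subdivide (reach-t (tgt e))) (λ ())
  ... | inj₁ β                = β
  ... | inj₂ (_ , e-in _ , β) = β

  out∉A : HEdge G (inj₁ a) z → ¬ A G (inj₁ a) z
  out∉A (out-e _) α = ReachAvoid-end (avoid-sole-pred pred-of-edge (λ ()) α) refl

  in∉B : HEdge G z (inj₁ b) → ¬ B G (inj₁ b) z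
  in∉B (e-in _) β = ReachAvoid-start (avoid-sole-succ succ-of-edge (λ ()) β) refl

  entry-from-s : ∀ b → b ≢ s → ∃ λ z → HEdge G z (inj₁ b) × A G (inj₁ b) z
  entry-from-s b b≢s with first-visit (subdivide (reach-s b)) (b≢s ∘ sym ∘ inj₁-injective)
  ... | inj₁ α     = ⊥-elim (ReachAvoid-end α refl)
  ... | inj₂ entry = entry

  exit-to-t : ∀ a → a ≢ t → ∃ λ z → HEdge G (inj₁ a) z × B G (inj₁ a) z
  exit-to-t a a≢t with last-visit (subdivide (reach-t a)) (a≢t ∘ sym ∘ inj₁-injective)
  ... | inj₁ β    = ⊥-elim (ReachAvoid-start β refl)
  ... | inj₂ exit = exit

  entry-unique : HEdge G p (inj₁ b) → ¬ A G p (inj₁ b) → HEdge G z (inj₁ b) → A G (inj₁ b) z → p ≡ z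
  entry-unique {z = z} (e-in f) ¬α e α with inj₂ f ≟ z
  ... | yes f≡z = f≡z
  ... | no f≢z  = ⊥-elim (¬α (ReachAvoid-snoc (avoid-sole-succ succ-of-edge (f≢z ∘ sym) α) e λ ()))

  exit-unique : HEdge G (inj₁ a) q → ¬ B G q (inj₁ a) → HEdge G (inj₁ a) z → B G (inj₁ a) z → q ≡ z
  exit-unique {z = z} (out-e f) ¬β e β with inj₂ f ≟ z
  ... | yes f≡z = f≡z
  ... | no f≢z  = ⊥-elim (¬β (step (λ ()) e (avoid-sole-pred pred-of-edge (f≢z ∘ sym) β)))

  ¬A-out-neighbours : HEdge G u w → ¬ A G u w → HEdge G u z → ¬ A G u z
  ¬A-out-neighbours _        _  e@(out-e _) = out∉A e
  ¬A-out-neighbours (e-in _) ¬α (e-in _)    = ¬α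

  ¬B-in-neighbours : HEdge G w u → ¬ B G u w → HEdge G z u → ¬ B G u z
  ¬B-in-neighbours _         _  e@(e-in _) = in∉B e
  ¬B-in-neighbours (out-e _) ¬β (out-e _)  = ¬β

  forward-edge : HEdge G u w → ¬ A G u w → IEdge G u w
  forward-edge e ¬α = inj₁ (((_ , e , ¬α) , λ _ e′ α _ → ¬A-out-neighbours e ¬α e′ α) , e , ¬α)

  backward-edge : HEdge G w u → ¬ B G u w → IEdge G u w
  backward-edge e ¬β = inj₂ (((_ , e , ¬β) , λ _ e′ _ β → ¬B-in-neighbours e ¬β e′ β) , e , ¬β)

  A-closed : B G (inj₂ e) (inj₁ (src e)) → IEdge G x y → A G (inj₂ e) y → A G (inj₂ e) x
  A-closed β (inj₁ (_ , _ , ¬α)) α with avoid-or-reach _ α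
  ... | inj₁ α′ = ⊥-elim (¬α α′)
  ... | inj₂ α′ = α′
  A-closed β (inj₂ (_ , out-e f , ¬β)) α = ReachAvoid-snoc α (out-e f) λ { refl → ¬β β }
  A-closed β (inj₂ (_ , e-in f , _))   α = ReachAvoid-snoc α (e-in f) λ ()

  B-closed : A G (inj₂ e) (inj₁ (tgt e)) → IEdge G x y → B G (inj₂ e) y → B G (inj₂ e) x
  B-closed α (inj₁ (_ , out-e f , _))  β = step (λ ()) (out-e f) β
  B-closed α (inj₁ (_ , e-in f , ¬α))  β = step (λ { refl → ¬α α }) (e-in f) β
  B-closed α (inj₂ (_ , _ , ¬β)) β with avoid-or-from _ β
  ... | inj₁ β′ = ⊥-elim (¬β β′)
  ... | inj₂ β′ = β′

  IEdge-reversible : IEdge G u w → IReach G w u → IEdge G w u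
  IEdge-reversible (inj₁ (_ , out-e e , _)) back =
    backward-edge (out-e e) λ β → ReachAvoid-end (Star-pull (A-closed β) back (pred∈A (out-e e))) refl
  IEdge-reversible (inj₁ (_ , e-in e , _))  back = backward-edge (e-in e) (in∉B (e-in e))
  IEdge-reversible (inj₂ (_ , out-e e , _)) back = forward-edge (out-e e) (out∉A (out-e e))
  IEdge-reversible (inj₂ (_ , e-in e , _))  back =
    forward-edge (e-in e) λ α → ReachAvoid-start (Star-pull (B-closed α) back (succ∈B (e-in e))) refl

  Mutual : HV G → HV G → Set
  Mutual p q = HEdge G p q × ¬ A G p q × ¬ B G q p

  Mutual? : Decidable Mutual
  Mutual? p q = HEdge? p q ×-dec ¬? (ReachAvoid? p (hs G) q) ×-dec ¬? (ReachAvoid? q p (ht G))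

  Mutual⇒IEdge : Mutual p q → IEdge G p q
  Mutual⇒IEdge (e , ¬α , _) = forward-edge e ¬α

  Mutual⇒IEdge⁻¹ : Mutual p q → IEdge G q p
  Mutual⇒IEdge⁻¹ (e , _ , ¬β) = backward-edge e ¬β

  IEdge-pair⇒Mutual : IEdge G p q → IEdge G q p → Mutual p q ⊎ Mutual q p
  IEdge-pair⇒Mutual (inj₁ (_ , e , ¬α)) (inj₂ (_ , _ , ¬β)) = inj₁ (e , ¬α , ¬β)
  IEdge-pair⇒Mutual (inj₂ (_ , e , ¬β)) (inj₁ (_ , _ , ¬α)) = inj₂ (e , ¬α , ¬β)
  IEdge-pair⇒Mutual (inj₁ (_ , out-e f , _))  (inj₁ (_ , _ , ¬α)) = ⊥-elim (¬α (pred∈A (out-e f)))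
  IEdge-pair⇒Mutual (inj₁ (_ , e-in f , ¬α))  (inj₁ (_ , e , _))  = ⊥-elim (¬α (pred∈A e))
  IEdge-pair⇒Mutual (inj₂ (_ , e-in f , _))   (inj₂ (_ , _ , ¬β)) = ⊥-elim (¬β (succ∈B (e-in f)))
  IEdge-pair⇒Mutual (inj₂ (_ , out-e f , ¬β)) (inj₂ (_ , e , _))  = ⊥-elim (¬β (succ∈B e))

  Mutual-deterministic : Deterministic _≡_ Mutual
  Mutual-deterministic (e-in f , _) (e , _) = sym (succ-of-edge e)
  Mutual-deterministic (out-e f , _ , ¬β) (e , _ , ¬β′) with exit-to-t (src f) (t-out0 f)
  ... | z , e″ , β = trans (exit-unique (out-e f) ¬β e″ β) (sym (exit-unique e ¬β′ e″ β))

  Mutual-codeterministic : Deterministic _≡_ (flip Mutual)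
  Mutual-codeterministic (out-e f , _) (e , _) = sym (pred-of-edge e)
  Mutual-codeterministic (e-in f , ¬α , _) (e , ¬α′ , _) with entry-from-s (tgt f) (s-in0 f)
  ... | z , e″ , α = trans (entry-unique (e-in f) ¬α e″ α) (sym (entry-unique e ¬α′ e″ α))

  StrictlyDominates : HV G → HV G → Set
  StrictlyDominates p q = ¬ A G p q × A G q p

  StrictlyDominates-trans : Transitive StrictlyDominates
  StrictlyDominates-trans {p} {q} {r} (¬αpq , αqp) (¬αqr , _) = ¬αpr , αrp
    where
    ¬αpr : ¬ A G p r
    ¬αpr α with avoid-or-reach q α
    ... | inj₁ αqr = ¬αqr αqr
    ... | inj₂ αpq = ¬αpq αpq
    αrp : A G r p
    αrp with avoid-or-reach r αqp
    ... | inj₁ α   = α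
    ... | inj₂ αqr = ⊥-elim (¬αqr αqr)

  Mutual⇒StrictlyDominates : Mutual p q → StrictlyDominates p q
  Mutual⇒StrictlyDominates (out-e f , ¬α , _) = ¬α , pred∈A (out-e f)
  Mutual⇒StrictlyDominates (e-in f , ¬α , _) with entry-from-s (tgt f) (s-in0 f)
  ... | z , e , α = ¬α , subst (A G _) (sym (entry-unique (e-in f) ¬α e α)) α

  Mutual-acyclic : Acyclic Mutual
  Mutual-acyclic r w = irreflexive (along (Mutual⇒StrictlyDominates r) w)
    where
    along : StrictlyDominates x y → Star Mutual y z → StrictlyDominates x z
    along d ε       = d
    along d (r ◅ w) = along (StrictlyDominates-trans d (Mutual⇒StrictlyDominates r)) w
    irreflexive : ¬ StrictlyDominates x x
    irreflexive (¬α , α) = ¬α α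

  module Component (C : HV G → Set) (scc : IsSCC G C) where

    open IsSCC scc

    C-forward : C x → Star Mutual x y → C y
    C-forward {x} {y} cx w = maximal x y cx (Star.map Mutual⇒IEdge w) (reverse Mutual⇒IEdge⁻¹ w)

    C-backward : C y → Star Mutual x y → C x
    C-backward {y} {x} cy w = maximal y x cy (reverse Mutual⇒IEdge⁻¹ w) (Star.map Mutual⇒IEdge w)

    module _ (w : Star Mutual p q) (source : ∀ z → ¬ Mutual z p) (sink : ∀ z → ¬ Mutual q z) where

      IReach-in-trace : IReach G x y → C x → C y → x ∈ trace w → y ∈ trace w
      IReach-in-trace ε _ _ x∈w = x∈w
      IReach-in-trace {x} {y} (_◅_ {j = z} i r) cx cy x∈w =
        IReach-in-trace r cz cy
          (trace-closed Mutual-deterministic Mutual-codeterministic source sink w x∈w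
             (IEdge-pair⇒Mutual i (IEdge-reversible i back)))
        where
        back : IReach G z x
        back = r ◅◅ connected y x cy cx
        cz : C z
        cz = maximal x z cx (i ◅ ε) back

      trace-is-C : C p → ∀ x → (x ∈ trace w → C x) × (C x → x ∈ trace w)
      trace-is-C cp x = (λ x∈w → C-forward cp (trace-reachable w x∈w))
                      , (λ cx → IReach-in-trace (connected _ x cp cx) cp cx (start∈trace w))

    alternating-path : ∃ λ ps → IsAlternatingPathOn G C ps
    alternating-path with nonempty
    ... | x₀ , cx₀ with source-reaching Mutual? Mutual-acyclic x₀
    ...   | p₀ , p₀⇝x₀ , source with sink-reachable Mutual? Mutual-acyclic p₀
    ...     | _ , w , sink =
      trace w , trace-unique Mutual-acyclic w ,
      trace-is-C w source sink (C-backward cx₀ p₀⇝x₀) ,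
      Linked.map proj₁ (trace-linked w) ,
      Linked.map (HEdge-alternates ∘ proj₁) (trace-linked w)

lemma10 : (G : CFG) (C : HV G → Set) → IsSCC G C → AtLeastTwo G C → ∃ λ ps → IsAlternatingPathOn G C ps
lemma10 G C scc _ = Subdivision.Component.alternating-path G C scc
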